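{- Let $\mathbf{A}=\langle A,\oplus,{}^*,0,\diamond,i\rangle$ be a non-trivial CMV-algebra (i.e. $0\neq 1$, where $1:=0^*$). Then $\mathbf{A}$ is not totally ordered, i.e. there exist $x,y\in A$ with neither $x\le y$ nor $y\le x$.
   Context: An MV-algebra is a structure $\langle A,\oplus,{}^*,0\rangle$ of type $(2,1,0)$ satisfying: $(x\oplus y)\oplus z=x\oplus(y\oplus z)$, $x\oplus y=y\oplus x$, $x\oplus 0=x$, $(x^*)^*=x$, $x\oplus 0^*=0^*$, $(x^*\oplus y)^*\oplus y=(y^*\oplus x)^*\oplus x$. Put $1:=0^*$; the order is $x\le y$ iff $x^*\oplus y=1$. A CMV-algebra is a structure $\langle A,\oplus,{}^*,0,\diamond,i\rangle$ such that $\langle A,\oplus,{}^*,0\rangle$ is an MV-algebra, $\langle A,\diamond,i\rangle$ is a monoid, and for all $x,y,z\in A$: $(y\oplus z)\diamond x=(y\diamond x)\oplus(z\diamond x)$, $x^*\diamond y=(x\diamond y)^*$, and $0\diamond x=0$. It is trivial if $0=1$. -}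

module Defs where

open import Level using (Level; suc; _⊔_)
open import Relation.Binary.PropositionalEquality using (_≡_)

record MVAlgebra (a : Level) : Set (suc a) where
  infixl 6 _⊕_
  infix 8 _*
  field
    Carrier : Set a
    _⊕_     : Carrier → Carrier → Carrier
    _*      : Carrier → Carrier
    𝟘       : Carrier
    ⊕-assoc : ∀ x y z → (x ⊕ y) ⊕ z ≡ x ⊕ (y ⊕ z)
    ⊕-comm  : ∀ x y → x ⊕ y ≡ y ⊕ x
    ⊕-unit  : ∀ x → x ⊕ 𝟘 ≡ x
    *-invol : ∀ x → (x *) * ≡ x
    ⊕-absorb : ∀ x → x ⊕ (𝟘 *) ≡ 𝟘 *
    luk     : ∀ x y → ((x *) ⊕ y) * ⊕ y ≡ ((y *) ⊕ x) * ⊕ x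

  𝟙 : Carrier
  𝟙 = 𝟘 *

  _≤_ : Carrier → Carrier → Set a
  x ≤ y = (x *) ⊕ y ≡ 𝟙

record CMVAlgebra (a : Level) : Set (suc a) where
  field
    mv : MVAlgebra a
  open MVAlgebra mv public
  infixl 7 _◇_
  field
    _◇_     : Carrier → Carrier → Carrier
    ι       : Carrier
    ◇-assoc : ∀ x y z → (x ◇ y) ◇ z ≡ x ◇ (y ◇ z)
    ◇-identityˡ : ∀ x → ι ◇ x ≡ x
    ◇-identityʳ : ∀ x → x ◇ ι ≡ x
    ◇-distrib-⊕ : ∀ x y z → (y ⊕ z) ◇ x ≡ (y ◇ x) ⊕ (z ◇ x)
    ◇-*         : ∀ x y → (x *) ◇ y ≡ (x ◇ y) *
    ◇-zero      : ∀ x → 𝟘 ◇ x ≡ 𝟘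

  Trivial : Set a
  Trivial = 𝟘 ≡ 𝟙

module Submission where

-- Call x a "half-cover" if x ⊕ x ≡ 𝟙.  Since right multiplication by any y
-- preserves ⊕ and 𝟙 (it preserves * and 𝟘), it maps half-covers to
-- half-covers; and 𝟘 is a half-cover only when 𝟘 ≡ 𝟙.  Hence in a non-trivial
-- algebra no half-cover is sent to 𝟘 by a right multiplication.
-- Now ι* ≤ ι says that ι is a half-cover, but ι ◇ 𝟘 ≡ 𝟘; and ι ≤ ι* says that
-- ι* is a half-cover, but ι* ◇ 𝟙 ≡ (ι ◇ 𝟙)* ≡ 𝟘.  Both are impossible.

open import Defs
open import Level using (Level)
open import Data.Product using (Σ; _×_; _,_)
open import Relation.Nullary using (¬_)
open import Relation.Binary.PropositionalEquality

module HalfCovers {a : Level} (A : CMVAlgebra a) where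
  open CMVAlgebra A
  open ≡-Reasoning

  HalfCover : Carrier → Set a
  HalfCover x = x ⊕ x ≡ 𝟙

  𝟙-◇ : ∀ y → 𝟙 ◇ y ≡ 𝟙
  𝟙-◇ y = trans (◇-* 𝟘 y) (cong _* (◇-zero y))

  ◇-halfCover : ∀ {x} y → HalfCover x → HalfCover (x ◇ y)
  ◇-halfCover {x} y half = begin
    (x ◇ y) ⊕ (x ◇ y) ≡⟨ sym (◇-distrib-⊕ y x x) ⟩
    (x ⊕ x) ◇ y       ≡⟨ cong (_◇ y) half ⟩
    𝟙 ◇ y             ≡⟨ 𝟙-◇ y ⟩
    𝟙                 ∎

  𝟘-halfCover⇒trivial : HalfCover 𝟘 → Trivial
  𝟘-halfCover⇒trivial half = trans (sym (⊕-unit 𝟘)) half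

  annihilated⇒¬halfCover : ¬ Trivial → ∀ {x} y → x ◇ y ≡ 𝟘 → ¬ HalfCover x
  annihilated⇒¬halfCover nt {x} y x◇y≡𝟘 half =
    nt (𝟘-halfCover⇒trivial (subst HalfCover x◇y≡𝟘 (◇-halfCover y half)))

  *≤⇒halfCover : ∀ {x} → (x *) ≤ x → HalfCover x
  *≤⇒halfCover {x} le = trans (cong (_⊕ x) (sym (*-invol x))) le

  ι*-◇-𝟙 : (ι *) ◇ 𝟙 ≡ 𝟘
  ι*-◇-𝟙 = begin
    (ι *) ◇ 𝟙 ≡⟨ ◇-* ι 𝟙 ⟩
    (ι ◇ 𝟙) * ≡⟨ cong _* (◇-identityˡ 𝟙) ⟩
    𝟙 *       ≡⟨ *-invol 𝟘 ⟩
    𝟘         ∎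

mainTheorem1 : {a : Level} (A : CMVAlgebra a) →
    let open CMVAlgebra A in
    ¬ Trivial →
    Σ Carrier (λ x → Σ Carrier (λ y → ¬ (x ≤ y) × ¬ (y ≤ x)))
mainTheorem1 A nt = ι , ι * , ι≰ι* , ι*≰ι
  where
  open CMVAlgebra A
  open HalfCovers A

  -- ι ≤ ι* unfolds to ι* ⊕ ι* ≡ 𝟙, i.e. to ι* being a half-cover.
  ι≰ι* : ¬ (ι ≤ (ι *))
  ι≰ι* = annihilated⇒¬halfCover nt 𝟙 ι*-◇-𝟙

  ι*≰ι : ¬ ((ι *) ≤ ι)
  ι*≰ι le = annihilated⇒¬halfCover nt 𝟘 (◇-identityˡ 𝟘) (*≤⇒halfCover le)
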